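{- Let $P$ be a finite path whose vertices are ordered from left to right (each vertex adjacent to its neighbours on the left and on the right), and let $L$ be a list assignment of $P$ such that every list $L(v)$ has size exactly $4$. For $n\ge 0$ let $C_n$ be the number of non-repetitive colorings of the $n$ leftmost vertices of $P$ respecting $L$ (with $C_0=1$, the empty coloring). Then for every integer $0\le n<|P|$ we have $C_{n+1}\ge 2C_n$.
   Context: A sequence $s_1\ldots s_{2k}$ ($k\ge1$) is a square if $s_i=s_{i+k}$ for all $i\in\{1,\ldots,k\}$. A sequence is non-repetitive if none of its consecutive subsequences (factors) is a square. A coloring of the vertices of a graph is non-repetitive if the sequence of colors along every (simple) path is non-repetitive. A list assignment $L$ maps each vertex $v$ to a set of colors $L(v)$; a coloring respects $L$ if each vertex $v$ receives a color from $L(v)$. For the path, a coloring of the $n$ leftmost vertices is non-repetitive iff the sequence of colors read from left to right has no square factor. -}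

module Defs where

open import Data.Nat using (ℕ; _≤_; _<_)
open import Data.Fin using (Fin; fromℕ<)
open import Data.List using (List; []; _∷_; _++_; length)
open import Data.List.Membership.Propositional using (_∈_)
open import Data.List.Relation.Unary.Unique.Propositional using (Unique)
open import Data.Product using (∃; ∃-syntax; _×_)
open import Relation.Binary.PropositionalEquality using (_≡_; _≢_)
open import Relation.Nullary using (¬_)

HasSquareFactor : List ℕ → Set
HasSquareFactor s = ∃[ u ] ∃[ x ] ∃[ w ] (x ≢ [] × s ≡ u ++ (x ++ (x ++ w)))

NonRepetitive : List ℕ → Set
NonRepetitive s = ¬ HasSquareFactor s

-- The path P has m vertices 0, …, m-1 from left to right.
-- A list assignment: each vertex gets a list of colors.
ListAssignment : ℕ → Set
ListAssignment m = Fin m → List ℕ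

Lists4 : ∀ {m} → ListAssignment m → Set
Lists4 {m} L = (v : Fin m) → Unique (L v) × length (L v) ≡ 4

data Respects {m : ℕ} (L : ListAssignment m) : (i : ℕ) → List ℕ → Set where
  done : ∀ {i} → Respects L i []
  next : ∀ {i c cs} (i<m : i < m) → c ∈ L (fromℕ< i<m) →
         Respects L (Data.Nat.suc i) cs → Respects L i (c ∷ cs)

GoodColoring : ∀ {m} → ListAssignment m → ℕ → List ℕ → Set
GoodColoring L n cs = length cs ≡ n × Respects L 0 cs × NonRepetitive cs

-- A list `es` is an exact enumeration (without repetition) of the
-- good colorings of the n leftmost vertices; then length es = C_n.
Enumerates : ∀ {m} → ListAssignment m → ℕ → List (List ℕ) → Set
Enumerates L n es = Unique es × (∀ cs → cs ∈ es → GoodColoring L n cs)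
                              × (∀ cs → GoodColoring L n cs → cs ∈ es)

-- Rosenfeld's counting argument. Let C n be the number of good colourings of the first n
-- vertices. Of the 4 C n one-letter extensions of good colourings of length n, each one
-- that is not good ends in a square u x x with u x good, and it is determined by u x and
-- the length n + 1; so there are at most Σ_{i ≤ n} C i of them, and
-- 4 C n ≤ C (n + 1) + Σ_{i ≤ n} C i. Induction on n then gives both C (n + 1) ≥ 2 C n and
-- Σ_{i ≤ n} C i ≤ 2 C n.

module Submission where

open import Defs
open import Data.Nat using (ℕ; zero; suc; _<_; _≤_; _*_; _+_; _∸_; s≤s; z≤n; _<?_)
open import Data.Nat.Properties
open import Data.Fin using (fromℕ<)
open import Data.List using (List; []; _∷_; _++_; _∷ʳ_; [_]; length; map; drop; filter; cartesianProductWith; initLast; _∷ʳ′_)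
open import Data.List.Properties using (length-++; length-map; length-++-≤ˡ; ++-assoc; ++-identityʳ; ∷ʳ-injective; ∷ʳ-injectiveˡ; ≡-dec)
open import Data.List.Membership.Propositional using (_∈_)
open import Data.List.Membership.Propositional.Properties
open import Data.List.Relation.Binary.Subset.Propositional using (_⊆_)
open import Data.List.Relation.Unary.Any using (here; there)
open import Data.List.Relation.Unary.Any.Properties using (¬Any[])
import Data.List.Relation.Unary.All as All
open import Data.List.Relation.Unary.Unique.Propositional using (Unique; []; _∷_)
import Data.List.Relation.Unary.Unique.Propositional.Properties as Unique
open import Data.Product using (∃₂; ∃-syntax; _×_; _,_; proj₁; proj₂)
open import Data.Sum using (inj₁; inj₂)
open import Data.Empty using (⊥-elim)
open import Relation.Nullary using (Dec; yes; no; ¬?; _×-dec_)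
open import Relation.Nullary.Decidable using (map′; decidable-stable)
open import Relation.Binary.PropositionalEquality using (_≡_; _≢_; refl; sym; trans; cong; cong₂; subst; subst₂; module ≡-Reasoning)

private variable A B C : Set

length-cartesianProductWith : (f : A → B → C) (xs : List A) (ys : List B) →
  length (cartesianProductWith f xs ys) ≡ length xs * length ys
length-cartesianProductWith f []       ys = refl
length-cartesianProductWith f (x ∷ xs) ys = begin
  length (map (f x) ys ++ cartesianProductWith f xs ys)          ≡⟨ length-++ (map (f x) ys) ⟩
  length (map (f x) ys) + length (cartesianProductWith f xs ys)  ≡⟨ cong₂ _+_ (length-map (f x) ys) (length-cartesianProductWith f xs ys) ⟩
  length ys + length xs * length ys                              ∎
  where open ≡-Reasoning

length-∷ʳ : ∀ (xs : List A) x → length (xs ∷ʳ x) ≡ suc (length xs)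
length-∷ʳ []       x = refl
length-∷ʳ (_ ∷ xs) x = cong suc (length-∷ʳ xs x)

drop-length-++ : ∀ (u x : List A) → drop (length u) (u ++ x) ≡ x
drop-length-++ []      x = refl
drop-length-++ (_ ∷ u) x = drop-length-++ u x

∈-++-∷⁻ : ∀ {x y : A} ys zs → y ∈ ys ++ x ∷ zs → y ≢ x → y ∈ ys ++ zs
∈-++-∷⁻ ys zs y∈ y≢x with ∈-++⁻ ys y∈
... | inj₁ y∈ys         = ∈-++⁺ˡ y∈ys
... | inj₂ (here y≡x)   = ⊥-elim (y≢x y≡x)
... | inj₂ (there y∈zs) = ∈-++⁺ʳ ys y∈zs

Unique-⊆⇒length≤ : {xs ys : List A} → Unique xs → xs ⊆ ys → length xs ≤ length ys
Unique-⊆⇒length≤ {xs = []}     _              _  = z≤n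
Unique-⊆⇒length≤ {xs = x ∷ xs} (x∉xs ∷ !xs) xs⊆ys with ∈-∃++ (xs⊆ys (here refl))
... | ys₁ , ys₂ , refl = begin
  suc (length xs)                  ≤⟨ s≤s (Unique-⊆⇒length≤ !xs xs⊆ys₁++ys₂) ⟩
  suc (length (ys₁ ++ ys₂))        ≡⟨ cong suc (length-++ ys₁) ⟩
  suc (length ys₁ + length ys₂)    ≡⟨ +-suc (length ys₁) (length ys₂) ⟨
  length ys₁ + length (x ∷ ys₂)    ≡⟨ length-++ ys₁ ⟨
  length (ys₁ ++ x ∷ ys₂)          ∎
  where
  open ≤-Reasoning
  xs⊆ys₁++ys₂ : xs ⊆ ys₁ ++ ys₂
  xs⊆ys₁++ys₂ y∈xs = ∈-++-∷⁻ ys₁ ys₂ (xs⊆ys (there y∈xs)) λ y≡x → All.lookup x∉xs y∈xs (sym y≡x)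

∷ʳ≡++⇒prefix : ∀ (xs : List A) {c} ys zs → zs ≢ [] → xs ∷ʳ c ≡ ys ++ zs → ∃[ zs′ ] xs ≡ ys ++ zs′
∷ʳ≡++⇒prefix xs ys zs zs≢[] eq with initLast zs
... | []        = ⊥-elim (zs≢[] refl)
... | zs′ ∷ʳ′ d = zs′ , ∷ʳ-injectiveˡ xs (ys ++ zs′) (trans eq (sym (++-assoc ys zs′ [ d ])))

∃-split? : {P : List A → List A → Set} → (∀ u v → Dec (P u v)) →
           ∀ s → Dec (∃₂ λ u v → s ≡ u ++ v × P u v)
∃-split? P? [] with P? [] []
... | yes p  = yes ([] , [] , refl , p)
... | no ¬p  = no λ where
  ([] , [] , refl , p) → ¬p p
∃-split? P? (a ∷ s) with P? [] (a ∷ s) | ∃-split? (λ u → P? (a ∷ u)) s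
... | yes p  | _                     = yes ([] , a ∷ s , refl , p)
... | no _   | yes (u , v , refl , p) = yes (a ∷ u , v , refl , p)
... | no ¬p  | no ¬q                 = no λ where
  ([] , _ , refl , p)    → ¬p p
  (_ ∷ u , v , refl , p) → ¬q (u , v , refl , p)

nonEmpty? : (xs : List A) → Dec (xs ≢ [])
nonEmpty? []      = no λ []≢[] → []≢[] refl
nonEmpty? (_ ∷ _) = yes λ ()

prefix? : (x r : List ℕ) → Dec (∃[ w ] r ≡ x ++ w)
prefix? x r = map′ (λ { (_ , w , r≡ , refl) → w , r≡ }) (λ (w , r≡) → x , w , r≡ , refl)
                   (∃-split? (λ y _ → ≡-dec _≟_ y x) r)

SquarePrefix : List ℕ → Set
SquarePrefix r = ∃₂ λ x w → x ≢ [] × r ≡ x ++ (x ++ w)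

squarePrefix? : ∀ r → Dec (SquarePrefix r)
squarePrefix? r = map′ (λ { (x , _ , r≡ , x≢[] , w , refl) → x , w , x≢[] , r≡ })
                       (λ (x , w , x≢[] , r≡) → x , x ++ w , r≡ , x≢[] , w , refl)
                       (∃-split? (λ x r′ → nonEmpty? x ×-dec prefix? x r′) r)

hasSquareFactor? : ∀ s → Dec (HasSquareFactor s)
hasSquareFactor? s = map′ (λ { (u , _ , s≡ , x , w , x≢[] , refl) → u , x , w , x≢[] , s≡ })
                          (λ (u , x , w , x≢[] , s≡) → u , x ++ (x ++ w) , s≡ , x , w , x≢[] , refl)
                          (∃-split? (λ _ r → squarePrefix? r) s)

nonRepetitive? : ∀ s → Dec (NonRepetitive s)
nonRepetitive? s = ¬? (hasSquareFactor? s)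

nonRepetitive-[] : NonRepetitive []
nonRepetitive-[] ([]    , []    , _ , []≢[] , _) = []≢[] refl
nonRepetitive-[] ([]    , _ ∷ _ , _ , _     , ())
nonRepetitive-[] (_ ∷ _ , _     , _ , _     , ())

++-square-assoc : ∀ (u x w t : List A) → (u ++ (x ++ (x ++ w))) ++ t ≡ u ++ (x ++ (x ++ (w ++ t)))
++-square-assoc u x w t = begin
  (u ++ (x ++ (x ++ w))) ++ t  ≡⟨ ++-assoc u _ t ⟩
  u ++ ((x ++ (x ++ w)) ++ t)  ≡⟨ cong (u ++_) (++-assoc x _ t) ⟩
  u ++ (x ++ ((x ++ w) ++ t))  ≡⟨ cong (λ z → u ++ (x ++ z)) (++-assoc x w t) ⟩
  u ++ (x ++ (x ++ (w ++ t)))  ∎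
  where open ≡-Reasoning

nonRepetitive-++ˡ : ∀ s t → NonRepetitive (s ++ t) → NonRepetitive s
nonRepetitive-++ˡ s t nr (u , x , w , x≢[] , refl) = nr (u , x , w ++ t , x≢[] , ++-square-assoc u x w t)

square-suffix : ∀ cs c → NonRepetitive cs → HasSquareFactor (cs ∷ʳ c) →
                ∃₂ λ u x → x ≢ [] × cs ∷ʳ c ≡ (u ++ x) ++ x
square-suffix cs c nr (u , x , w , x≢[] , eq) with initLast w
... | []        = u , x , x≢[] , trans eq (trans (cong (λ z → u ++ (x ++ z)) (++-identityʳ x)) (sym (++-assoc u x x)))
... | w′ ∷ʳ′ d  = ⊥-elim (nr (u , x , w′ , x≢[] ,
                    ∷ʳ-injectiveˡ cs (u ++ (x ++ (x ++ w′))) (trans eq (sym (++-square-assoc u x w′ [ d ])))))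

repeatSuffix : ℕ → List A → List A
repeatSuffix k t = t ++ drop (length t ∸ k) t

repeatSuffix-++ : ∀ (u x : List A) → repeatSuffix (length x) (u ++ x) ≡ (u ++ x) ++ x
repeatSuffix-++ u x = cong ((u ++ x) ++_) (begin
  drop (length (u ++ x) ∸ length x) (u ++ x)       ≡⟨ cong (λ k → drop (k ∸ length x) (u ++ x)) (length-++ u) ⟩
  drop (length u + length x ∸ length x) (u ++ x)   ≡⟨ cong (λ k → drop k (u ++ x)) (m+n∸n≡m (length u) (length x)) ⟩
  drop (length u) (u ++ x)                         ≡⟨ drop-length-++ u x ⟩
  x                                                ∎)
  where open ≡-Reasoning

partialSum : (ℕ → ℕ) → ℕ → ℕ
partialSum a zero    = 0
partialSum a (suc n) = a n + partialSum a n

doubling : (a : ℕ → ℕ) (m : ℕ) → (∀ n → n < m → 4 * a n ≤ a (suc n) + partialSum a (suc n)) →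
           ∀ n → n < m → 2 * a n ≤ a (suc n)
doubling a m grows = doubles
  where
  partialSum≤ : ∀ n → n < m → partialSum a (suc n) ≤ 2 * a n
  doubles : ∀ n → n < m → 2 * a n ≤ a (suc n)

  partialSum≤ zero    _     = +-monoʳ-≤ (a 0) z≤n
  partialSum≤ (suc n) 1+n<m = +-monoʳ-≤ (a (suc n)) (begin
    partialSum a (suc n)  ≤⟨ partialSum≤ n n<m ⟩
    2 * a n               ≤⟨ doubles n n<m ⟩
    a (suc n)             ≡⟨ +-identityʳ (a (suc n)) ⟨
    a (suc n) + 0         ∎)
    where
    open ≤-Reasoning
    n<m = <-trans (n<1+n n) 1+n<m

  doubles n n<m = +-cancelʳ-≤ (2 * a n) (2 * a n) (a (suc n)) (begin
    2 * a n + 2 * a n                    ≡⟨ *-distribʳ-+ (a n) 2 2 ⟨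
    4 * a n                              ≤⟨ grows n n<m ⟩
    a (suc n) + partialSum a (suc n)     ≤⟨ +-monoʳ-≤ (a (suc n)) (partialSum≤ n n<m) ⟩
    a (suc n) + 2 * a n                  ∎)
    where open ≤-Reasoning

module _ {m : ℕ} (L : ListAssignment m) where

  -- the list of vertex k, extended by [] to the vertices beyond the path
  colours : ℕ → List ℕ
  colours k with k <? m
  ... | yes k<m = L (fromℕ< k<m)
  ... | no  _   = []

  ∈-colours⁺ : ∀ {k c} (k<m : k < m) → c ∈ L (fromℕ< k<m) → c ∈ colours k
  ∈-colours⁺ {k} k<m c∈ with k <? m
  ... | yes _   = c∈
  ... | no  k≮m = ⊥-elim (k≮m k<m)

  ∈-colours⁻ : ∀ {k c} → c ∈ colours k → ∃[ k<m ] c ∈ L (fromℕ< {k} {m} k<m)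
  ∈-colours⁻ {k} c∈ with k <? m
  ... | yes k<m = k<m , c∈
  ... | no  _   = ⊥-elim (¬Any[] c∈)

  length-colours : ∀ {d} → (∀ v → length (L v) ≡ d) → ∀ {k} → k < m → length (colours k) ≡ d
  length-colours length-L {k} k<m with k <? m
  ... | yes k<m′ = length-L (fromℕ< k<m′)
  ... | no  k≮m  = ⊥-elim (k≮m k<m)

  ∈-colours-resp : ∀ {c k k′} → k ≡ k′ → c ∈ colours k → c ∈ colours k′
  ∈-colours-resp refl c∈ = c∈

  Respects-++ˡ : ∀ {i} cs ds → Respects L i (cs ++ ds) → Respects L i cs
  Respects-++ˡ []       ds _                = done
  Respects-++ˡ (c ∷ cs) ds (next i<m c∈ r) = next i<m c∈ (Respects-++ˡ cs ds r)

  Respects-∷ʳ⁺ : ∀ {i} cs {c} → Respects L i cs → c ∈ colours (i + length cs) → Respects L i (cs ∷ʳ c)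
  Respects-∷ʳ⁺ {i} []       done            c∈ with ∈-colours⁻ (∈-colours-resp (+-identityʳ i) c∈)
  ... | i<m , c∈L = next i<m c∈L done
  Respects-∷ʳ⁺ {i} (_ ∷ cs) (next i<m c∈ r) c′∈ =
    next i<m c∈ (Respects-∷ʳ⁺ cs r (∈-colours-resp (+-suc i (length cs)) c′∈))

  Respects-∷ʳ⁻ : ∀ {i} cs {c} → Respects L i (cs ∷ʳ c) → c ∈ colours (i + length cs)
  Respects-∷ʳ⁻ {i} []       (next i<m c∈ _) = ∈-colours-resp (sym (+-identityʳ i)) (∈-colours⁺ i<m c∈)
  Respects-∷ʳ⁻ {i} (_ ∷ cs) (next _ _ r)    = ∈-colours-resp (sym (+-suc i (length cs))) (Respects-∷ʳ⁻ cs r)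

module Counting {m : ℕ} (L : ListAssignment m) (L-Unique : ∀ v → Unique (L v)) where

  Unique-colours : ∀ k → Unique (colours L k)
  Unique-colours k with k <? m
  ... | yes k<m = L-Unique (fromℕ< k<m)
  ... | no  _   = []

  extensions : List (List ℕ) → ℕ → List (List ℕ)
  extensions es k = cartesianProductWith _∷ʳ_ es (colours L k)

  Unique-extensions : ∀ {es} k → Unique es → Unique (extensions es k)
  Unique-extensions k !es = Unique.cartesianProductWith⁺ _∷ʳ_ (λ {w} {x} → ∷ʳ-injective w x) !es (Unique-colours k)

  good : ℕ → List (List ℕ)
  good zero    = [ [] ]
  good (suc k) = filter nonRepetitive? (extensions (good k) k)

  count : ℕ → ℕ
  count k = length (good k)

  Unique-good : ∀ k → Unique (good k)
  Unique-good zero    = All.[] ∷ []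
  Unique-good (suc k) = Unique.filter⁺ nonRepetitive? (Unique-extensions k (Unique-good k))

  good-sound : ∀ k {cs} → cs ∈ good k → GoodColoring L k cs
  good-sound zero    (here refl) = refl , done , nonRepetitive-[]
  good-sound (suc k) cs∈ with ∈-filter⁻ nonRepetitive? {xs = extensions (good k) k} cs∈
  ... | e∈ , nr with ∈-cartesianProductWith⁻ _∷ʳ_ (good k) (colours L k) e∈
  ... | cs , c , cs∈ , c∈ , refl with good-sound k cs∈
  ... | refl , r , _ = length-∷ʳ cs c , Respects-∷ʳ⁺ L cs r c∈ , nr

  good-complete : ∀ k {cs} → GoodColoring L k cs → cs ∈ good k
  good-complete zero {[]} _ = here refl
  good-complete (suc k) {cs′} (len , r , nr) with initLast cs′
  ... | cs ∷ʳ′ c = ∈-filter⁺ nonRepetitive? (∈-cartesianProductWith⁺ _∷ʳ_ cs∈ c∈) nr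
    where
    length-cs : length cs ≡ k
    length-cs = suc-injective (trans (sym (length-∷ʳ cs c)) len)
    cs∈ : cs ∈ good k
    cs∈ = good-complete k (length-cs , Respects-++ˡ L cs [ c ] r , nonRepetitive-++ˡ cs [ c ] nr)
    c∈ : c ∈ colours L k
    c∈ = ∈-colours-resp L length-cs (Respects-∷ʳ⁻ L cs r)

  enumeration-length : ∀ k {es} → Enumerates L k es → length es ≡ count k
  enumeration-length k {es} (!es , sound , complete) = ≤-antisym
    (Unique-⊆⇒length≤ !es λ {cs} cs∈ → good-complete k (sound cs cs∈))
    (Unique-⊆⇒length≤ (Unique-good k) λ {cs} cs∈ → complete cs (good-sound k cs∈))

  squareCompletions : ℕ → ℕ → List (List ℕ)
  squareCompletions N zero    = []
  squareCompletions N (suc i) = map (repeatSuffix (N ∸ i)) (good i) ++ squareCompletions N i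

  length-squareCompletions : ∀ N k → length (squareCompletions N k) ≡ partialSum count k
  length-squareCompletions N zero    = refl
  length-squareCompletions N (suc i) = trans (length-++ (map (repeatSuffix (N ∸ i)) (good i)))
    (cong₂ _+_ (length-map (repeatSuffix (N ∸ i)) (good i)) (length-squareCompletions N i))

  ∈-squareCompletions : ∀ N k {i t} → i < k → t ∈ good i → repeatSuffix (N ∸ i) t ∈ squareCompletions N k
  ∈-squareCompletions N (suc k) {i} (s≤s i≤k) t∈ with m≤n⇒m<n∨m≡n i≤k
  ... | inj₁ i<k  = ∈-++⁺ʳ _ (∈-squareCompletions N k i<k t∈)
  ... | inj₂ refl = ∈-++⁺ˡ (∈-map⁺ (repeatSuffix (N ∸ i)) t∈)

  repetitive-extension∈squareCompletions : ∀ n {cs c} → cs ∈ good n → HasSquareFactor (cs ∷ʳ c) →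
                                           cs ∷ʳ c ∈ squareCompletions (suc n) (suc n)
  repetitive-extension∈squareCompletions n {cs} {c} cs∈ sq
    with good-sound n cs∈
  ... | length-cs , r , nr
    with square-suffix cs c nr sq
  ... | u , x , x≢[] , cs∷ʳc≡
    with ∷ʳ≡++⇒prefix cs (u ++ x) x x≢[] cs∷ʳc≡
  ... | x′ , refl = subst (_∈ squareCompletions (suc n) (suc n)) completion≡ t∈squareCompletions
    where
    t = u ++ x
    t∈ : t ∈ good (length t)
    t∈ = good-complete (length t) (refl , Respects-++ˡ L t x′ r , nonRepetitive-++ˡ t x′ nr)
    length-t+x : length t + length x ≡ suc n
    length-t+x = begin
      length t + length x     ≡⟨ length-++ t ⟨
      length (t ++ x)         ≡⟨ cong length cs∷ʳc≡ ⟨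
      length ((t ++ x′) ∷ʳ c) ≡⟨ length-∷ʳ (t ++ x′) c ⟩
      suc (length (t ++ x′))  ≡⟨ cong suc length-cs ⟩
      suc n                   ∎
      where open ≡-Reasoning
    t∈squareCompletions : repeatSuffix (suc n ∸ length t) t ∈ squareCompletions (suc n) (suc n)
    t∈squareCompletions = ∈-squareCompletions (suc n) (suc n)
      (s≤s (subst (length t ≤_) length-cs (length-++-≤ˡ t))) t∈
    completion≡ : repeatSuffix (suc n ∸ length t) t ≡ (t ++ x′) ∷ʳ c
    completion≡ = begin
      repeatSuffix (suc n ∸ length t) t              ≡⟨ cong (λ N → repeatSuffix (N ∸ length t) t) length-t+x ⟨
      repeatSuffix (length t + length x ∸ length t) t ≡⟨ cong (λ k → repeatSuffix k t) (m+n∸m≡n (length t) (length x)) ⟩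
      repeatSuffix (length x) t                       ≡⟨ repeatSuffix-++ u x ⟩
      t ++ x                                          ≡⟨ cs∷ʳc≡ ⟨
      (t ++ x′) ∷ʳ c                                  ∎
      where open ≡-Reasoning

  extensions⊆ : ∀ n → extensions (good n) n ⊆ good (suc n) ++ squareCompletions (suc n) (suc n)
  extensions⊆ n e∈ with ∈-cartesianProductWith⁻ _∷ʳ_ (good n) (colours L n) e∈
  ... | cs , c , cs∈ , _ , refl with nonRepetitive? (cs ∷ʳ c)
  ... | yes nr = ∈-++⁺ˡ (∈-filter⁺ nonRepetitive? e∈ nr)
  ... | no ¬nr = ∈-++⁺ʳ (good (suc n)) (repetitive-extension∈squareCompletions n cs∈ (decidable-stable (hasSquareFactor? _) ¬nr))

  counting : ∀ n → length (colours L n) * count n ≤ count (suc n) + partialSum count (suc n)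
  counting n = begin
    length (colours L n) * count n                                   ≡⟨ *-comm (length (colours L n)) (count n) ⟩
    count n * length (colours L n)                                   ≡⟨ length-cartesianProductWith _∷ʳ_ (good n) (colours L n) ⟨
    length (extensions (good n) n)                                   ≤⟨ Unique-⊆⇒length≤ (Unique-extensions n (Unique-good n)) (extensions⊆ n) ⟩
    length (good (suc n) ++ squareCompletions (suc n) (suc n))       ≡⟨ length-++ (good (suc n)) ⟩
    count (suc n) + length (squareCompletions (suc n) (suc n))       ≡⟨ cong (count (suc n) +_) (length-squareCompletions (suc n) (suc n)) ⟩
    count (suc n) + partialSum count (suc n)                         ∎
    where open ≤-Reasoning

lemma1 : (m : ℕ) (L : ListAssignment m) → Lists4 L →
         (n : ℕ) → n < m →
         (es : List (List ℕ)) → Enumerates L n es →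
         (fs : List (List ℕ)) → Enumerates L (Data.Nat.suc n) fs →
         2 * length es ≤ length fs
lemma1 m L L4 n n<m es enum-es fs enum-fs =
  subst₂ (λ a b → 2 * a ≤ b) (sym (enumeration-length n enum-es)) (sym (enumeration-length (suc n) enum-fs))
    (doubling count m four-times n n<m)
  where
  open Counting L (λ v → proj₁ (L4 v))
  four-times : ∀ k → k < m → 4 * count k ≤ count (suc k) + partialSum count (suc k)
  four-times k k<m = subst (λ d → d * count k ≤ count (suc k) + partialSum count (suc k)) (length-colours L (λ v → proj₂ (L4 v)) k<m) (counting k)
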